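{- Let $\mathcal S$ be a generalized KM-arc of type $(0,m,t)$ in a projective plane $\Pi_q$ of order $q$, with $t\neq m$. Then each point of $\mathcal S$ is incident with exactly one $t$-secant and exactly $q$ $m$-secants of $\mathcal S$.
   Context: A generalized KM-arc of type $(0,m,t)$ in a projective plane of order $q$ is a proper non-empty subset $\mathcal S$ of the points with $|\mathcal S|=q(m-1)+t$ such that every line meets $\mathcal S$ in $0$, $m$ or $t$ points. An $i$-secant is a line meeting $\mathcal S$ in exactly $i$ points. -}

module Defs where

open import Data.Nat using (ℕ; suc; _+_; _*_; _∸_)
open import Data.Fin using (Fin)
open import Data.Bool using (Bool; true; false; if_then_else_)
open import Data.List using (List; filter; length)
open import Data.List.Relation.Unary.All using (All)
open import Data.Fin.Base using ()
open import Data.List using (allFin)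
open import Data.Product using (Σ; _×_; ∃-syntax)
open import Relation.Binary.PropositionalEquality using (_≡_; _≢_)
open import Relation.Nullary using (¬_; Dec)
open import Relation.Unary using (Pred; Decidable)
open import Level using (0ℓ)
import Data.Bool
import Data.Nat
import Data.Sum
import Relation.Nullary

count : {n : ℕ} → (P : Pred (Fin n) 0ℓ) → Decidable P → ℕ
count {n} P P? = length (filter P? (allFin n))

record IncidenceStructure : Set₁ where
  field
    nPoints nLines : ℕ
    _I_  : Fin nPoints → Fin nLines → Set
    _I?_ : (p : Fin nPoints) → (l : Fin nLines) → Dec (p I l)

  Point = Fin nPoints
  Line  = Fin nLines

  pointsOn : Line → ℕ
  pointsOn l = count (λ p → p I l) (λ p → p I? l)

record IsProjectivePlane (Π : IncidenceStructure) : Set where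
  open IncidenceStructure Π
  field
    two-points : (p r : Point) → p ≢ r →
      Σ Line λ l → (p I l) × (r I l) ×
        ((l′ : Line) → p I l′ → r I l′ → l′ ≡ l)
    two-lines : (l m : Line) → l ≢ m →
      Σ Point λ p → (p I l) × (p I m) ×
        ((p′ : Point) → p′ I l → p′ I m → p′ ≡ p)
    quadrangle : Σ Point λ a → Σ Point λ b → Σ Point λ c → Σ Point λ d →
      (a ≢ b) × (a ≢ c) × (a ≢ d) × (b ≢ c) × (b ≢ d) × (c ≢ d) ×
      ((l : Line) → ¬ ((a I l) × (b I l) × (c I l))) ×
      ((l : Line) → ¬ ((a I l) × (b I l) × (d I l))) ×
      ((l : Line) → ¬ ((a I l) × (c I l) × (d I l))) ×
      ((l : Line) → ¬ ((b I l) × (c I l) × (d I l)))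

record ProjectivePlaneOfOrder (Π : IncidenceStructure) (q : ℕ) : Set where
  open IncidenceStructure Π
  field
    isProjectivePlane : IsProjectivePlane Π
    order : (l : Line) → pointsOn l ≡ suc q

module _ (Π : IncidenceStructure) where
  open IncidenceStructure Π

  PointSet : Set
  PointSet = Point → Bool

  size : PointSet → ℕ
  size S = count (λ p → S p ≡ true) (λ p → Data.Bool._≟_ (S p) true)

  meet : PointSet → Line → ℕ
  meet S l = count (λ p → (p I l) × (S p ≡ true))
                   (λ p → (p I? l) Relation.Nullary.×-dec Data.Bool._≟_ (S p) true)

  secantsThrough : PointSet → ℕ → Point → ℕ
  secantsThrough S i p =
    count (λ l → (p I l) × (meet S l ≡ i))
          (λ l → (p I? l) Relation.Nullary.×-dec Data.Nat._≟_ (meet S l) i)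

  record IsGenKMArc (q m t : ℕ) (S : PointSet) : Set where
    field
      nonempty : ∃[ p ] S p ≡ true
      proper   : ∃[ p ] S p ≡ false
      size≡    : size S + q ≡ q * m + t  -- i.e. |S| = q(m-1)+t over ℤ
      lineMeet : (l : Line) →
        (meet S l ≡ 0) Data.Sum.⊎ (meet S l ≡ m) Data.Sum.⊎ (meet S l ≡ t)

module Submission where

-- For any weight T on the points, every point r ≠ p lies on exactly one line
-- through p, while p lies on all of them; hence (the pencil identity)
--     ∑_{l ∋ p} ∑_{r ∈ l} T r  +  T p  =  ∑_r T r  +  #(lines through p) · T p.
-- Taking T = the indicator of a line missing p shows that p lies on q + 1
-- lines; taking T = the indicator of S gives  ∑_{l ∋ p} |l ∩ S| = |S| + q.
-- Every line through p meets S (in p), so it is a t-secant or an m-secant.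
-- With A t-secants and B m-secants through p we get A + B = q + 1 and
-- A·t + B·m = |S| + q = q·m + t, and since t ≠ m this forces A = 1, B = q.

open import Defs
open import Data.Nat using (ℕ; zero; suc; _+_; _*_; _≤_)
open import Data.Nat.Properties
open import Data.Bool using (true)
open import Data.Fin using (Fin; punchIn)
open import Data.Fin.Properties using (punchInᵢ≢i)
open import Data.List using (filter; length; tabulate)
open import Data.Product using (_×_; _,_; Σ)
open import Data.Sum using (_⊎_; inj₁; inj₂)
open import Data.Empty using (⊥-elim)
open import Function using (_∘_)
open import Level using (0ℓ)
open import Relation.Binary.PropositionalEquality
  using (_≡_; _≢_; refl; sym; trans; cong; cong₂; subst; module ≡-Reasoning)
open import Relation.Nullary using (¬_; Dec; yes; no; _×-dec_)
open import Relation.Unary using (Pred; Decidable)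
open import Data.Nat.Tactic.RingSolver using (solve-∀)
open import Algebra.Properties.Semiring.Sum +-*-semiring
  using (sum; sum-syntax; sum-cong-≗; sum-remove; sum-replicate-zero;
         ∑-comm; ∑-distrib-+; *-distribˡ-sum)
import Data.Bool
import Data.Nat

⟦_⟧ : ∀ {a} {A : Set a} → Dec A → ℕ
⟦ yes _ ⟧ = 1
⟦ no _ ⟧ = 0

⟦⟧-yes : ∀ {a} {A : Set a} → A → (d : Dec A) → ⟦ d ⟧ ≡ 1
⟦⟧-yes x (yes _) = refl
⟦⟧-yes x (no ¬x) = ⊥-elim (¬x x)

⟦⟧-no : ∀ {a} {A : Set a} → ¬ A → (d : Dec A) → ⟦ d ⟧ ≡ 0
⟦⟧-no ¬x (yes x) = ⊥-elim (¬x x)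
⟦⟧-no ¬x (no _) = refl

⟦×-dec⟧ : ∀ {a b} {A : Set a} {B : Set b} (d : Dec A) (e : Dec B) →
  ⟦ d ×-dec e ⟧ ≡ ⟦ d ⟧ * ⟦ e ⟧
⟦×-dec⟧ (yes _) (yes _) = refl
⟦×-dec⟧ (yes _) (no _) = refl
⟦×-dec⟧ (no _) _ = refl

⟦⟧-idem : ∀ {a} {A : Set a} (d : Dec A) → ⟦ d ⟧ * ⟦ d ⟧ ≡ ⟦ d ⟧ * 1
⟦⟧-idem (yes _) = refl
⟦⟧-idem (no _) = refl

count-as-sum : ∀ {n} {P : Pred (Fin n) 0ℓ} (P? : Decidable P) →
  count P P? ≡ ∑[ x < n ] ⟦ P? x ⟧
count-as-sum P? = length-filter-tabulate (λ x → x)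
  where
  length-filter-tabulate : ∀ {k} (f : Fin k → Fin _) →
    length (filter P? (tabulate f)) ≡ ∑[ i < k ] ⟦ P? (f i) ⟧
  length-filter-tabulate {zero} f = refl
  length-filter-tabulate {suc k} f with P? (f Fin.zero)
  ... | yes _ = cong suc (length-filter-tabulate (f ∘ Fin.suc))
  ... | no _ = length-filter-tabulate (f ∘ Fin.suc)

sum-agree-off : ∀ {n} (f g : Fin n → ℕ) (i : Fin n) →
  (∀ j → j ≢ i → f j ≡ g j) → sum f + g i ≡ sum g + f i
sum-agree-off {suc n} f g i agree = begin
  sum f + g i                        ≡⟨ cong (_+ g i) (sum-remove {i = i} f) ⟩
  f i + sum (f ∘ punchIn i) + g i    ≡⟨ cong (λ s → f i + s + g i) same-rest ⟩
  f i + sum (g ∘ punchIn i) + g i    ≡⟨ rearrange (f i) _ (g i) ⟩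
  g i + sum (g ∘ punchIn i) + f i    ≡⟨ cong (_+ f i) (sym (sum-remove {i = i} g)) ⟩
  sum g + f i                        ∎
  where
  open ≡-Reasoning
  same-rest : sum (f ∘ punchIn i) ≡ sum (g ∘ punchIn i)
  same-rest = sum-cong-≗ (λ j → agree (punchIn i j) (punchInᵢ≢i i j))
  rearrange : ∀ a s b → a + s + b ≡ b + s + a
  rearrange = solve-∀

sum-single : ∀ {n} (f : Fin n → ℕ) (i : Fin n) →
  (∀ j → j ≢ i → f j ≡ 0) → sum f ≡ f i
sum-single {n} f i vanish = begin
  sum f                   ≡⟨ +-identityʳ (sum f) ⟨
  sum f + 0               ≡⟨ sum-agree-off f (λ _ → 0) i vanish ⟩
  sum {n} (λ _ → 0) + f i ≡⟨ cong (_+ f i) (sum-replicate-zero n) ⟩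
  f i                     ∎
  where open ≡-Reasoning

term≤sum : ∀ {n} (f : Fin n → ℕ) (i : Fin n) → f i ≤ sum f
term≤sum {suc n} f i = subst (f i ≤_) (sym (sum-remove {i = i} f)) (m≤m+n _ _)

∑-unique-common : ∀ {n} {A B : Fin n → Set}
  (A? : ∀ y → Dec (A y)) (B? : ∀ y → Dec (B y)) (x : Fin n) →
  A x → B x → (∀ y → A y → B y → y ≡ x) →
  ∑[ y < n ] (⟦ A? y ⟧ * ⟦ B? y ⟧) ≡ 1
∑-unique-common A? B? x ax bx unique =
  trans (sum-single _ x vanish) (cong₂ _*_ (⟦⟧-yes ax (A? x)) (⟦⟧-yes bx (B? x)))
  where
  vanish : ∀ y → y ≢ x → ⟦ A? y ⟧ * ⟦ B? y ⟧ ≡ 0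
  vanish y y≢x with A? y | B? y
  ... | yes ay | yes by = ⊥-elim (y≢x (unique y ay by))
  ... | yes _  | no _   = refl
  ... | no _   | _      = refl

two-weight-count : ∀ {q m t} A B → t ≢ m →
  A + B ≡ suc q → A * t + B * m ≡ q * m + t → (A ≡ 1) × (B ≡ q)
two-weight-count {q} {m} zero B t≢m total weighted rewrite total =
  ⊥-elim (t≢m (sym (+-cancelˡ-≡ (q * m) m _ (trans (+-comm (q * m) m) weighted))))
two-weight-count (suc zero) B t≢m total weighted = refl , suc-injective total
two-weight-count {q} {m} {t} (suc (suc k)) B t≢m total weighted
  rewrite sym (suc-injective total) =
  ⊥-elim (t≢m (*-cancelˡ-≡ t m (suc k) (+-cancelʳ-≡ _ _ _ (begin
    suc k * t + (B * m + t)      ≡⟨ expand-left k t B m ⟩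
    suc (suc k) * t + B * m      ≡⟨ weighted ⟩
    (suc k + B) * m + t          ≡⟨ expand-right k t B m ⟩
    suc k * m + (B * m + t)      ∎))))
  where
  open ≡-Reasoning
  expand-left : ∀ k t B m → suc k * t + (B * m + t) ≡ suc (suc k) * t + B * m
  expand-left = solve-∀
  expand-right : ∀ k t B m → (suc k + B) * m + t ≡ suc k * m + (B * m + t)
  expand-right = solve-∀

JoiningLines : IncidenceStructure → Set
JoiningLines Π = (p r : Point) → p ≢ r →
  Σ Line λ l → (p I l) × (r I l) × ((l′ : Line) → p I l′ → r I l′ → l′ ≡ l)
  where open IncidenceStructure Π

module Pencil (Π : IncidenceStructure) where
  open IncidenceStructure Π

  ∑through : Point → (Line → ℕ) → ℕ
  ∑through p f = ∑[ l < nLines ] (⟦ p I? l ⟧ * f l)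

  linesThrough : Point → ℕ
  linesThrough p = ∑through p (λ _ → 1)

  ∑through-cong : ∀ p {f g : Line → ℕ} → (∀ l → p I l → f l ≡ g l) →
    ∑through p f ≡ ∑through p g
  ∑through-cong p {f} {g} f≡g = sum-cong-≗ term
    where
    term : ∀ l → ⟦ p I? l ⟧ * f l ≡ ⟦ p I? l ⟧ * g l
    term l with p I? l
    ... | yes pl = cong (1 *_) (f≡g l pl)
    ... | no _ = refl

  ∑through-+ : ∀ p (f g : Line → ℕ) →
    ∑through p (λ l → f l + g l) ≡ ∑through p f + ∑through p g
  ∑through-+ p f g = trans (sum-cong-≗ (λ l → *-distribˡ-+ ⟦ p I? l ⟧ (f l) (g l)))
                           (∑-distrib-+ (λ l → ⟦ p I? l ⟧ * f l) (λ l → ⟦ p I? l ⟧ * g l))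

  ∑through-*ˡ : ∀ p c (f : Line → ℕ) → ∑through p (λ l → c * f l) ≡ c * ∑through p f
  ∑through-*ˡ p c f = begin
    ∑[ l < nLines ] (⟦ p I? l ⟧ * (c * f l))  ≡⟨ sum-cong-≗ (λ l → x*[c*y]≡c*[x*y] ⟦ p I? l ⟧ c (f l)) ⟩
    ∑[ l < nLines ] (c * (⟦ p I? l ⟧ * f l))  ≡⟨ *-distribˡ-sum c (λ l → ⟦ p I? l ⟧ * f l) ⟨
    c * ∑through p f                           ∎
    where
    open ≡-Reasoning
    x*[c*y]≡c*[x*y] : ∀ x c y → x * (c * y) ≡ c * (x * y)
    x*[c*y]≡c*[x*y] = solve-∀

  module _ (join : JoiningLines Π) where

    commonLines : Point → Point → ℕ
    commonLines p r = ∑through p (λ l → ⟦ r I? l ⟧)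

    commonLines-distinct : ∀ p r → r ≢ p → commonLines p r ≡ 1
    commonLines-distinct p r r≢p with join p r (r≢p ∘ sym)
    ... | l , pl , rl , unique = ∑-unique-common (p I?_) (r I?_) l pl rl unique

    commonLines-self : ∀ p → commonLines p p ≡ linesThrough p
    commonLines-self p = sum-cong-≗ (λ l → ⟦⟧-idem (p I? l))

    -- The pencil identity: double count the incident pairs (r, l) with
    -- p ∈ l, weighting r by T r.
    pencil-identity : ∀ p (T : Point → ℕ) →
      ∑through p (λ l → ∑[ r < nPoints ] (⟦ r I? l ⟧ * T r)) + T p ≡
      ∑[ r < nPoints ] T r + linesThrough p * T p
    pencil-identity p T = begin
      ∑through p (λ l → ∑[ r < nPoints ] (⟦ r I? l ⟧ * T r)) + T p
        ≡⟨ cong (_+ T p) exchange ⟩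
      ∑[ r < nPoints ] (T r * commonLines p r) + T p
        ≡⟨ sum-agree-off _ T p off-p ⟩
      ∑[ r < nPoints ] T r + T p * commonLines p p
        ≡⟨ cong (λ c → ∑[ r < nPoints ] T r + T p * c) (commonLines-self p) ⟩
      ∑[ r < nPoints ] T r + T p * linesThrough p
        ≡⟨ cong (∑[ r < nPoints ] T r +_) (*-comm (T p) (linesThrough p)) ⟩
      ∑[ r < nPoints ] T r + linesThrough p * T p   ∎
      where
      open ≡-Reasoning
      regroup : ∀ a b x → a * (b * x) ≡ x * (a * b)
      regroup = solve-∀
      exchange : ∑through p (λ l → ∑[ r < nPoints ] (⟦ r I? l ⟧ * T r)) ≡
                 ∑[ r < nPoints ] (T r * commonLines p r)
      exchange = begin
        ∑[ l < nLines ] (⟦ p I? l ⟧ * ∑[ r < nPoints ] (⟦ r I? l ⟧ * T r))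
          ≡⟨ sum-cong-≗ (λ l → *-distribˡ-sum ⟦ p I? l ⟧ (λ r → ⟦ r I? l ⟧ * T r)) ⟩
        ∑[ l < nLines ] ∑[ r < nPoints ] (⟦ p I? l ⟧ * (⟦ r I? l ⟧ * T r))
          ≡⟨ ∑-comm (λ l r → ⟦ p I? l ⟧ * (⟦ r I? l ⟧ * T r)) ⟩
        ∑[ r < nPoints ] ∑[ l < nLines ] (⟦ p I? l ⟧ * (⟦ r I? l ⟧ * T r))
          ≡⟨ sum-cong-≗ (λ r → sum-cong-≗ (λ l → regroup ⟦ p I? l ⟧ ⟦ r I? l ⟧ (T r))) ⟩
        ∑[ r < nPoints ] ∑[ l < nLines ] (T r * (⟦ p I? l ⟧ * ⟦ r I? l ⟧))
          ≡⟨ sum-cong-≗ (λ r → *-distribˡ-sum (T r) (λ l → ⟦ p I? l ⟧ * ⟦ r I? l ⟧)) ⟨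
        ∑[ r < nPoints ] (T r * commonLines p r)   ∎
      off-p : ∀ r → r ≢ p → T r * commonLines p r ≡ T r
      off-p r r≢p = trans (cong (T r *_) (commonLines-distinct p r r≢p)) (*-identityʳ (T r))

module ProjectivePlaneCounts (Π : IncidenceStructure) (q : ℕ)
  (plane : ProjectivePlaneOfOrder Π q) where
  open IncidenceStructure Π
  open ProjectivePlaneOfOrder plane
  open IsProjectivePlane isProjectivePlane
  open Pencil Π

  joining-unique : ∀ {x y l l′} → x ≢ y → x I l → y I l → x I l′ → y I l′ → l ≡ l′
  joining-unique {x} {y} x≢y xl yl xl′ yl′ with two-points x y x≢y
  ... | _ , _ , _ , unique = trans (unique _ xl yl) (sym (unique _ xl′ yl′))

  -- With a, b, c three non-collinear points
  -- of the quadrangle: if p lies on both bc and ac, then p = c (otherwise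
  -- bc = ac and a, b, c would be collinear), and then ab misses p.
  line-missing : (p : Point) → Σ Line λ l → ¬ (p I l)
  line-missing p with quadrangle
  ... | a , b , c , _ , a≢b , a≢c , _ , b≢c , _ , _ , abc-noncollinear , _
    with two-points b c b≢c | two-points a c a≢c
  ... | bc , b-bc , c-bc , _ | ac , a-ac , c-ac , _ with p I? bc | p I? ac
  ... | no p∉bc | _ = bc , p∉bc
  ... | yes _ | no p∉ac = ac , p∉ac
  ... | yes p-bc | yes p-ac with p Data.Fin.≟ c
  ... | no p≢c = ⊥-elim (abc-noncollinear bc
          (subst (a I_) (joining-unique p≢c p-ac c-ac p-bc c-bc) a-ac , b-bc , c-bc))
  ... | yes refl with two-points a b a≢b
  ... | ab , a-ab , b-ab , _ = ab , λ c-ab → abc-noncollinear ab (a-ab , b-ab , c-ab)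

  meets-once : ∀ {l l₀} → l ≢ l₀ → ∑[ r < nPoints ] (⟦ r I? l ⟧ * ⟦ r I? l₀ ⟧) ≡ 1
  meets-once {l} {l₀} l≢l₀ with two-lines l l₀ l≢l₀
  ... | x , xl , xl₀ , unique = ∑-unique-common (_I? l) (_I? l₀) x xl xl₀ unique

  -- Every point lies on q + 1 lines: apply the pencil identity to the
  -- indicator of a line l₀ missing p; each line through p meets l₀ once.
  linesThrough≡ : ∀ p → linesThrough p ≡ suc q
  linesThrough≡ p with line-missing p
  ... | l₀ , p∉l₀ = begin
    linesThrough p
      ≡⟨ ∑through-cong p (λ l pl → sym (meets-once (λ { refl → p∉l₀ pl }))) ⟩
    pencilSum
      ≡⟨ +-identityʳ pencilSum ⟨
    pencilSum + 0
      ≡⟨ cong (pencilSum +_) Tp≡0 ⟨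
    pencilSum + T p
      ≡⟨ pencil-identity two-points p T ⟩
    ∑[ r < nPoints ] T r + linesThrough p * T p
      ≡⟨ cong₂ _+_ (sym (count-as-sum (_I? l₀))) (cong (linesThrough p *_) Tp≡0) ⟩
    pointsOn l₀ + linesThrough p * 0
      ≡⟨ cong₂ _+_ (order l₀) (*-zeroʳ (linesThrough p)) ⟩
    suc q + 0
      ≡⟨ +-identityʳ (suc q) ⟩
    suc q   ∎
    where
    open ≡-Reasoning
    T : Point → ℕ
    T r = ⟦ r I? l₀ ⟧
    Tp≡0 : T p ≡ 0
    Tp≡0 = ⟦⟧-no p∉l₀ (p I? l₀)
    pencilSum : ℕ
    pencilSum = ∑through p (λ l → ∑[ r < nPoints ] (⟦ r I? l ⟧ * T r))

module PointSetCounts (Π : IncidenceStructure) (S : PointSet Π) where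
  open IncidenceStructure Π
  open Pencil Π

  inS : Point → ℕ
  inS r = ⟦ Data.Bool._≟_ (S r) true ⟧

  size-as-sum : size Π S ≡ ∑[ r < nPoints ] inS r
  size-as-sum = count-as-sum (λ r → Data.Bool._≟_ (S r) true)

  meet-as-sum : ∀ l → meet Π S l ≡ ∑[ r < nPoints ] (⟦ r I? l ⟧ * inS r)
  meet-as-sum l = trans (count-as-sum (λ r → (r I? l) ×-dec Data.Bool._≟_ (S r) true))
                        (sum-cong-≗ (λ r → ⟦×-dec⟧ (r I? l) (Data.Bool._≟_ (S r) true)))

  secantsThrough-as-sum : ∀ i p →
    secantsThrough Π S i p ≡ ∑through p (λ l → ⟦ Data.Nat._≟_ (meet Π S l) i ⟧)
  secantsThrough-as-sum i p =
    trans (count-as-sum (λ l → (p I? l) ×-dec Data.Nat._≟_ (meet Π S l) i))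
          (sum-cong-≗ (λ l → ⟦×-dec⟧ (p I? l) (Data.Nat._≟_ (meet Π S l) i)))

  meet-positive : ∀ {p l} → S p ≡ true → p I l → meet Π S l ≢ 0
  meet-positive {p} {l} Sp pl meet≡0 = 1+n≰n (begin
    1                                        ≡⟨ sym (cong₂ _*_ (⟦⟧-yes pl (p I? l)) (⟦⟧-yes Sp _)) ⟩
    ⟦ p I? l ⟧ * inS p                       ≤⟨ term≤sum _ p ⟩
    ∑[ r < nPoints ] (⟦ r I? l ⟧ * inS r)    ≡⟨ sym (meet-as-sum l) ⟩
    meet Π S l                               ≡⟨ meet≡0 ⟩
    0                                        ∎)
    where open ≤-Reasoning

  -- The pencil identity for the indicator of S:  the line sizes |l ∩ S|
  -- over the pencil at p ∈ S count every point of S once, and p once per line.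
  pencil-meets : JoiningLines Π → ∀ p → S p ≡ true →
    ∑through p (meet Π S) + 1 ≡ size Π S + linesThrough p
  pencil-meets join p Sp = begin
    ∑through p (meet Π S) + 1
      ≡⟨ cong₂ _+_ (sum-cong-≗ (λ l → cong (⟦ p I? l ⟧ *_) (meet-as-sum l))) (sym inS-p) ⟩
    ∑through p (λ l → ∑[ r < nPoints ] (⟦ r I? l ⟧ * inS r)) + inS p
      ≡⟨ pencil-identity join p inS ⟩
    ∑[ r < nPoints ] inS r + linesThrough p * inS p
      ≡⟨ cong₂ _+_ (sym size-as-sum) (trans (cong (linesThrough p *_) inS-p) (*-identityʳ _)) ⟩
    size Π S + linesThrough p   ∎
    where
    open ≡-Reasoning
    inS-p : inS p ≡ 1
    inS-p = ⟦⟧-yes Sp _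

  module _ {m t : ℕ} (t≢m : t ≢ m) (p : Point)
    (twoSecantTypes : ∀ l → p I l → meet Π S l ≡ t ⊎ meet Π S l ≡ m) where

    private
      isT isM : Line → ℕ
      isT l = ⟦ Data.Nat._≟_ (meet Π S l) t ⟧
      isM l = ⟦ Data.Nat._≟_ (meet Π S l) m ⟧

      classify : ∀ l → p I l → (isT l ≡ 1 × isM l ≡ 0 × meet Π S l ≡ t)
                             ⊎ (isT l ≡ 0 × isM l ≡ 1 × meet Π S l ≡ m)
      classify l pl with twoSecantTypes l pl
      ... | inj₁ ≡t = inj₁ (⟦⟧-yes ≡t _ , ⟦⟧-no (λ ≡m → t≢m (trans (sym ≡t) ≡m)) _ , ≡t)
      ... | inj₂ ≡m = inj₂ (⟦⟧-no (λ ≡t → t≢m (trans (sym ≡t) ≡m)) _ , ⟦⟧-yes ≡m _ , ≡m)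

    lines-split : linesThrough p ≡ secantsThrough Π S t p + secantsThrough Π S m p
    lines-split = begin
      linesThrough p                          ≡⟨ ∑through-cong p one-type ⟩
      ∑through p (λ l → isT l + isM l)        ≡⟨ ∑through-+ p isT isM ⟩
      ∑through p isT + ∑through p isM         ≡⟨ sym (cong₂ _+_ (secantsThrough-as-sum t p)
                                                                (secantsThrough-as-sum m p)) ⟩
      secantsThrough Π S t p + secantsThrough Π S m p   ∎
      where
      open ≡-Reasoning
      one-type : ∀ l → p I l → 1 ≡ isT l + isM l
      one-type l pl with classify l pl
      ... | inj₁ (isT≡1 , isM≡0 , _) = sym (cong₂ _+_ isT≡1 isM≡0)
      ... | inj₂ (isT≡0 , isM≡1 , _) = sym (cong₂ _+_ isT≡0 isM≡1)

    meets-split : ∑through p (meet Π S) ≡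
                  secantsThrough Π S t p * t + secantsThrough Π S m p * m
    meets-split = begin
      ∑through p (meet Π S)                          ≡⟨ ∑through-cong p by-type ⟩
      ∑through p (λ l → t * isT l + m * isM l)       ≡⟨ ∑through-+ p _ _ ⟩
      ∑through p (λ l → t * isT l) + ∑through p (λ l → m * isM l)
        ≡⟨ cong₂ _+_ (∑through-*ˡ p t isT) (∑through-*ˡ p m isM) ⟩
      t * ∑through p isT + m * ∑through p isM
        ≡⟨ sym (cong₂ (λ a b → t * a + m * b) (secantsThrough-as-sum t p)
                                             (secantsThrough-as-sum m p)) ⟩
      t * secantsThrough Π S t p + m * secantsThrough Π S m p
        ≡⟨ cong₂ _+_ (*-comm t _) (*-comm m _) ⟩
      secantsThrough Π S t p * t + secantsThrough Π S m p * m   ∎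
      where
      open ≡-Reasoning
      by-type : ∀ l → p I l → meet Π S l ≡ t * isT l + m * isM l
      by-type l pl with classify l pl
      ... | inj₁ (isT≡1 , isM≡0 , ≡t) rewrite isT≡1 | isM≡0 =
        trans ≡t (sym (trans (cong₂ _+_ (*-identityʳ t) (*-zeroʳ m)) (+-identityʳ t)))
      ... | inj₂ (isT≡0 , isM≡1 , ≡m) rewrite isT≡0 | isM≡1 =
        trans ≡m (sym (cong₂ _+_ (*-zeroʳ t) (*-identityʳ m)))

proposition2p2 : (Π : IncidenceStructure) (q : ℕ) → ProjectivePlaneOfOrder Π q →
    (m t : ℕ) (S : PointSet Π) → IsGenKMArc Π q m t S → t ≢ m →
    (p : IncidenceStructure.Point Π) → S p ≡ true →
    (secantsThrough Π S t p ≡ 1) × (secantsThrough Π S m p ≡ q)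
proposition2p2 Π q plane m t S arc t≢m p Sp =
  two-weight-count (secantsThrough Π S t p) (secantsThrough Π S m p) t≢m total weighted
  where
  open IncidenceStructure Π
  open IsGenKMArc arc
  open Pencil Π
  open ProjectivePlaneCounts Π q plane
  open PointSetCounts Π S
  open IsProjectivePlane (ProjectivePlaneOfOrder.isProjectivePlane plane) using (two-points)
  open ≡-Reasoning

  secantTypes : ∀ l → p I l → meet Π S l ≡ t ⊎ meet Π S l ≡ m
  secantTypes l pl with lineMeet l
  ... | inj₁ ≡0 = ⊥-elim (meet-positive Sp pl ≡0)
  ... | inj₂ (inj₁ ≡m) = inj₂ ≡m
  ... | inj₂ (inj₂ ≡t) = inj₁ ≡t

  total : secantsThrough Π S t p + secantsThrough Π S m p ≡ suc q
  total = trans (sym (lines-split t≢m p secantTypes)) (linesThrough≡ p)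

  weighted : secantsThrough Π S t p * t + secantsThrough Π S m p * m ≡ q * m + t
  weighted = begin
    secantsThrough Π S t p * t + secantsThrough Π S m p * m
      ≡⟨ meets-split t≢m p secantTypes ⟨
    ∑through p (meet Π S)
      ≡⟨ +-cancelʳ-≡ 1 _ _ (begin
           ∑through p (meet Π S) + 1         ≡⟨ pencil-meets two-points p Sp ⟩
           size Π S + linesThrough p         ≡⟨ cong (size Π S +_) (linesThrough≡ p) ⟩
           size Π S + suc q                  ≡⟨ +-suc (size Π S) q ⟩
           suc (size Π S + q)                ≡⟨ +-comm 1 (size Π S + q) ⟩
           size Π S + q + 1                  ∎) ⟩
    size Π S + q
      ≡⟨ size≡ ⟩
    q * m + t   ∎
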